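{- Let $\Lambda$ be a restorative similarity type, let $\mathfrak{M}=\langle W,R,\{P_k\}_{k\in K}\rangle$ be a Kripke model, and let $S\subseteq W\times W$ be a $\Lambda$-simulation on $\mathfrak{M}$. Then for every formula $\varphi\in\mathcal{L}_\Lambda$ and all $w,v\in W$ with $(w,v)\in S$: if $\mathfrak{M},w\Vdash\varphi$ then $\mathfrak{M},v\Vdash\varphi$.
   Context: Fix a set $K$ of indices for propositional letters $p_k$ ($k\in K$). Consider six unary connectives $\smile,\frown,\circ_\smile,\circ_\frown,\bullet_\smile,\bullet_\frown$. A restorative similarity type is any subset $\Lambda\subseteq\{\smile,\frown,\circ_\smile,\circ_\frown,\bullet_\smile,\bullet_\frown\}$. The language $\mathcal{L}_\Lambda$ is generated by $\phi::=p_k\mid\top\mid\bot\mid\phi\wedge\phi\mid\phi\vee\phi\mid\star\phi$ with $k\in K$, $\star\in\Lambda$. A Kripke model is $\mathfrak{M}=\langle W,R,\{P_k\}_{k\in K}\rangle$ with $W$ a nonempty set, $R\subseteq W\times W$ and each $P_k\subseteq W$. Satisfaction: $w\Vdash p_k$ iff $w\in P_k$; $\top$ is true everywhere and $\bot$ nowhere; $\wedge,\vee$ classical; $w\Vdash\smile\phi$ iff some $v$ with $wRv$ has $v\not\Vdash\phi$; $w\Vdash\frown\phi$ iff every $v$ with $wRv$ has $v\not\Vdash\phi$; $w\Vdash\circ_\smile\phi$ iff $w\not\Vdash\phi$ or every $v$ with $wRv$ has $v\Vdash\phi$; $w\Vdash\circ_\frown\phi$ iff $w\Vdash\phi$ or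 every $v$ with $wRv$ has $v\not\Vdash\phi$; $w\Vdash\bullet_\smile\phi$ iff $w\Vdash\phi$ and some $v$ with $wRv$ has $v\not\Vdash\phi$; $w\Vdash\bullet_\frown\phi$ iff $w\not\Vdash\phi$ and some $v$ with $wRv$ has $v\Vdash\phi$. A relation $S\subseteq W\times W$ is a $\Lambda$-simulation on $\mathfrak{M}$ if it satisfies (Sim$_k$) for every $k\in K$ and (Sim$\star$) for every $\star\in\Lambda$, where (all quantified worlds range over $W$): (Sim$_k$) if $(w,v)\in S$ and $w\in P_k$ then $v\in P_k$; (Sim$\smile$) if $(w,v)\in S$ and $wRs$ then there is $t$ with $vRt$ and $(t,s)\in S$; (Sim$\frown$) if $(w,v)\in S$ and $vRt$ then there is $s$ with $wRs$ and $(t,s)\in S$; (Sim$\circ_\smile$) if $(w,v)\in S$ and $vRt$ then either $(v,t)\in S$, or both $(v,w)\in S$ and there is $s$ with $wRs$ and $(s,t)\in S$; (Sim$\circ_\frown$) if $(w,v)\in S$ and $vRt$ then either $(t,v)\in S$, or there is $s$ with $wRs$ and $(t,s)\in S$; (Sim$\bullet_\smile$) if $(w,v)\in S$ and $wRs$ then either $(w,s)\in S$, or there is $t$ with $vRt$ and $(t,s)\in S$; (Sim$\bullet_\frown$) if $(w,v)\in S$ and $wRs$ then either $(s,w)\in S$, or both $(v,w)\in S$ and there is $t$ with $vRt$ and $(s,t)\in S$. -}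

module Defs where

open import Data.Product using (Σ; _×_; ∃)
open import Data.Sum using (_⊎_)
open import Data.Unit using (⊤)
open import Data.Empty using (⊥)
open import Relation.Nullary using (¬_)

-- The six unary connectives:
-- smile = ⌣, frown = ⌢, circSmile = ∘⌣, circFrown = ∘⌢, bulSmile = •⌣, bulFrown = •⌢
data Conn : Set where
  smile frown circSmile circFrown bulSmile bulFrown : Conn

SimType : Set₁
SimType = Conn → Set

data Form (K : Set) (Λ : SimType) : Set where
  var  : K → Form K Λ
  tt   : Form K Λ
  ff   : Form K Λ
  _∧_  : Form K Λ → Form K Λ → Form K Λ
  _∨_  : Form K Λ → Form K Λ → Form K Λ
  un   : (c : Conn) → Λ c → Form K Λ → Form K Λ

record Model (K : Set) : Set₁ where
  field
    W   : Set
    w₀  : W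
    R   : W → W → Set
    P   : K → W → Set

module _ {K : Set} {Λ : SimType} (M : Model K) where
  open Model M

  ⟦_⟧c : Conn → (W → Set) → W → Set
  ⟦ smile ⟧c     A w = Σ W λ v → R w v × ¬ A v
  ⟦ frown ⟧c     A w = ∀ v → R w v → ¬ A v
  ⟦ circSmile ⟧c A w = ¬ A w ⊎ (∀ v → R w v → A v)
  ⟦ circFrown ⟧c A w = A w ⊎ (∀ v → R w v → ¬ A v)
  ⟦ bulSmile ⟧c  A w = A w × (Σ W λ v → R w v × ¬ A v)
  ⟦ bulFrown ⟧c  A w = ¬ A w × (Σ W λ v → R w v × A v)

  _⊩_ : W → Form K Λ → Set
  w ⊩ var k     = P k w
  w ⊩ tt        = ⊤
  w ⊩ ff        = ⊥
  w ⊩ (φ ∧ ψ)   = (w ⊩ φ) × (w ⊩ ψ)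
  w ⊩ (φ ∨ ψ)   = (w ⊩ φ) ⊎ (w ⊩ ψ)
  w ⊩ un c _ φ  = ⟦ c ⟧c (λ u → u ⊩ φ) w

module _ {K : Set} (M : Model K) where
  open Model M

  SimClause : Conn → (W → W → Set) → Set
  SimClause smile S = ∀ w v s → S w v → R w s → Σ W λ t → R v t × S t s
  SimClause frown S = ∀ w v t → S w v → R v t → Σ W λ s → R w s × S t s
  SimClause circSmile S = ∀ w v t → S w v → R v t →
    S v t ⊎ (S v w × (Σ W λ s → R w s × S s t))
  SimClause circFrown S = ∀ w v t → S w v → R v t →
    S t v ⊎ (Σ W λ s → R w s × S t s)
  SimClause bulSmile S = ∀ w v s → S w v → R w s →
    S w s ⊎ (Σ W λ t → R v t × S t s)
  SimClause bulFrown S = ∀ w v s → S w v → R w s →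
    S s w ⊎ (S v w × (Σ W λ t → R v t × S s t))

  record IsSimulation (Λ : SimType) (S : W → W → Set) : Set where
    field
      simVar  : ∀ k w v → S w v → P k w → P k v
      simConn : ∀ c → Λ c → SimClause c S

{-# OPTIONS --safe #-}
module Submission where

open import Defs
open import Axiom.ExcludedMiddle using (ExcludedMiddle)
open import Level using (0ℓ)
open import Data.Product as Product using (_,_)
open import Data.Sum as Sum using (inj₁; inj₂; [_,_])
open import Data.Unit using (tt)
open import Function using (case_of_)
open import Relation.Binary.Definitions using (_Respects_)
open import Relation.Nullary using (yes; no; contradiction)

-- Each simulation clause is exactly what is needed to push the
-- semantics of its connective along S, given that the truth set of the
-- argument is already S-closed.  The two restoration connectives ∘⌣ and ∘⌢
-- are disjunctions whose witnessing side at v need not match the one at w,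
-- so they are decided at v by excluded middle.

module _ {K : Set} (Λ : SimType) (M : Model K) {S : Model.W M → Model.W M → Set}
         {A : Model.W M → Set} (A-respects : A Respects S) where
  open Model M

  -- ⟦_⟧c ignores Λ; it is fixed here only so that it can be inferred.
  ⟦_⟧ : Conn → (W → Set) → W → Set
  ⟦_⟧ = ⟦_⟧c {K} {Λ} M

  ⌣-respects : SimClause M smile S → ⟦ smile ⟧ A Respects S
  ⌣-respects clause {w} {v} Swv (s , wRs , ¬As) with clause w v s Swv wRs
  ... | t , vRt , Sts = t , vRt , λ At → ¬As (A-respects Sts At)

  ⌢-respects : SimClause M frown S → ⟦ frown ⟧ A Respects S
  ⌢-respects clause {w} {v} Swv ¬A-succ t vRt At with clause w v t Swv vRt
  ... | s , wRs , Sts = ¬A-succ s wRs (A-respects Sts At)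

  ∘⌣-respects : ExcludedMiddle 0ℓ → SimClause M circSmile S → ⟦ circSmile ⟧ A Respects S
  ∘⌣-respects em clause {w} {v} Swv restored-w with em {A v}
  ... | no ¬Av = inj₁ ¬Av
  ... | yes Av = inj₂ λ t vRt → case clause w v t Swv vRt of λ where
    (inj₁ Svt) → A-respects Svt Av
    (inj₂ (Svw , s , wRs , Sst)) →
      [ contradiction (A-respects Svw Av) , (λ A-succ → A-respects Sst (A-succ s wRs)) ] restored-w

  ∘⌢-respects : ExcludedMiddle 0ℓ → SimClause M circFrown S → ⟦ circFrown ⟧ A Respects S
  ∘⌢-respects em clause {w} {v} Swv restored-w with em {A v}
  ... | yes Av = inj₁ Av
  ... | no ¬Av = inj₂ λ t vRt At → case clause w v t Swv vRt of λ where
    (inj₁ Stv) → ¬Av (A-respects Stv At)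
    (inj₂ (s , wRs , Sts)) →
      [ (λ Aw → ¬Av (A-respects Swv Aw)) , (λ ¬A-succ → ¬A-succ s wRs (A-respects Sts At)) ] restored-w

  •⌣-respects : SimClause M bulSmile S → ⟦ bulSmile ⟧ A Respects S
  •⌣-respects clause {w} {v} Swv (Aw , s , wRs , ¬As) with clause w v s Swv wRs
  ... | inj₁ Sws = contradiction (A-respects Sws Aw) ¬As
  ... | inj₂ (t , vRt , Sts) = A-respects Swv Aw , t , vRt , λ At → ¬As (A-respects Sts At)

  •⌢-respects : SimClause M bulFrown S → ⟦ bulFrown ⟧ A Respects S
  •⌢-respects clause {w} {v} Swv (¬Aw , s , wRs , As) with clause w v s Swv wRs
  ... | inj₁ Ssw = contradiction (A-respects Ssw As) ¬Aw
  ... | inj₂ (Svw , t , vRt , Sst) = (λ Av → ¬Aw (A-respects Svw Av)) , t , vRt , A-respects Sst As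

  ⟦_⟧-respects : ∀ c → ExcludedMiddle 0ℓ → SimClause M c S → ⟦ c ⟧ A Respects S
  ⟦ smile     ⟧-respects em = ⌣-respects
  ⟦ frown     ⟧-respects em = ⌢-respects
  ⟦ circSmile ⟧-respects em = ∘⌣-respects em
  ⟦ circFrown ⟧-respects em = ∘⌢-respects em
  ⟦ bulSmile  ⟧-respects em = •⌣-respects
  ⟦ bulFrown  ⟧-respects em = •⌢-respects

lemma4p2 : ExcludedMiddle 0ℓ →
    {K : Set} (Λ : SimType) (M : Model K) (S : Model.W M → Model.W M → Set) →
    IsSimulation M Λ S →
    (φ : Form K Λ) (w v : Model.W M) → S w v →
    _⊩_ {K} {Λ} M w φ → _⊩_ {K} {Λ} M v φ
lemma4p2 em {K} Λ M S sim φ w v = ⊩-respects φ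
  where
  open IsSimulation sim

  ⊩-respects : ∀ φ → (λ u → _⊩_ {K} {Λ} M u φ) Respects S
  ⊩-respects (var k)    = simVar k _ _
  ⊩-respects tt         = λ _ _ → tt
  ⊩-respects ff         = λ _ ()
  ⊩-respects (φ ∧ ψ)    = λ Swv → Product.map (⊩-respects φ Swv) (⊩-respects ψ Swv)
  ⊩-respects (φ ∨ ψ)    = λ Swv → Sum.map (⊩-respects φ Swv) (⊩-respects ψ Swv)
  ⊩-respects (un c l φ) = ⟦_⟧-respects Λ M (⊩-respects φ) c em (simConn c l)
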